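{- Let $F$ be a field of characteristic $p>0$, and let $A_1,\dots,A_n$ be finite additive subgroups of $F$. Let $f\in F[X_1,\dots,X_n]$ be a polynomial with \[\deg(f)<n\,\big(\min\{|A_1|,\dots,|A_n|\}-1\big).\] Then $\sum_{a\in A_1\times\dots\times A_n}f(a)=0$.
   Context: $\deg(f)$ is the total degree of $f$. -}

module Defs where

open import Level using (_⊔_)
open import Algebra.Bundles using (CommutativeRing)
open import Data.Nat as ℕ using (ℕ; zero; suc; _⊓_; _⊔_)
open import Data.Product using (_×_; _,_; ∃-syntax)
open import Data.List using (List; []; _∷_; foldr; length)
open import Data.List.Relation.Unary.Any using (Any)
open import Data.List.Relation.Unary.AllPairs using (AllPairs)
open import Data.Vec using (Vec; []; _∷_)
open import Relation.Nullary using (¬_)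

module _ {c ℓ} (R : CommutativeRing c ℓ) where
  open CommutativeRing R

  record IsField : Set (c Level.⊔ ℓ) where
    field
      1≉0     : ¬ (1# ≈ 0#)
      inverse : ∀ x → ¬ (x ≈ 0#) → ∃[ y ] (x * y ≈ 1#)

  natCast : ℕ → Carrier
  natCast zero    = 0#
  natCast (suc n) = 1# + natCast n

  HasCharacteristic : ℕ → Set ℓ
  HasCharacteristic p =
    (0 ℕ.< p) × (natCast p ≈ 0#) × (∀ m → 0 ℕ.< m → natCast m ≈ 0# → p ℕ.≤ m)

  _∈_ : Carrier → List Carrier → Set (c Level.⊔ ℓ)
  x ∈ A = Any (x ≈_) A

  -- a finite subset of the field, given as a duplicate-free list (up to ≈),
  -- which is an additive subgroup
  record IsFiniteAdditiveSubgroup (A : List Carrier) : Set (c Level.⊔ ℓ) where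
    field
      distinct : AllPairs (λ x y → ¬ (x ≈ y)) A
      zero-mem : 0# ∈ A
      +-closed : ∀ x y → x ∈ A → y ∈ A → (x + y) ∈ A
      neg-closed : ∀ x → x ∈ A → (- x) ∈ A

  pow : Carrier → ℕ → Carrier
  pow x zero    = 1#
  pow x (suc k) = x * pow x k

  -- polynomials in n variables as finite lists of terms (coefficient, exponent vector)
  Poly : ℕ → Set c
  Poly n = List (Carrier × Vec ℕ n)

  monomial : ∀ {n} → Vec ℕ n → Vec Carrier n → Carrier
  monomial []       []       = 1#
  monomial (e ∷ es) (x ∷ xs) = pow x e * monomial es xs

  eval : ∀ {n} → Poly n → Vec Carrier n → Carrier
  eval f x = foldr (λ { (a , es) acc → a * monomial es x + acc }) 0# f

  expSum : ∀ {n} → Vec ℕ n → ℕ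
  expSum []       = 0
  expSum (e ∷ es) = e ℕ.+ expSum es

  deg : ∀ {n} → Poly n → ℕ
  deg f = foldr (λ { (a , es) acc → expSum es ℕ.⊔ acc }) 0 f

  minCard : ∀ {n} → Vec (List Carrier) n → ℕ
  minCard []           = 0
  minCard (A ∷ [])     = length A
  minCard (A ∷ B ∷ As) = length A ⊓ minCard (B ∷ As)

  sumOver : ∀ {n} → Vec (List Carrier) n → (Vec Carrier n → Carrier) → Carrier
  sumOver []       g = g []
  sumOver (A ∷ As) g = foldr (λ a acc → sumOver As (λ v → g (a ∷ v)) + acc) 0# A

-- For a finite additive subgroup A of a field and j < |A| - 1 the power sum Σ_{a ∈ A} a^j vanishes.
-- Let D = ∏_{b ∈ A, b ≠ 0} b.  For x ∈ A the map b ↦ x - b sends A ∖ {x} onto A ∖ {0}, so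
-- ∏_{b ≠ x} (x - b) = D, and the polynomial Σ_{a ∈ A} a^j ∏_{b ≠ a} (X - b) - D X^j vanishes on A.
-- It has fewer than |A| coefficients, hence is zero; its coefficient of X^{|A|-1} is Σ_a a^j.
-- Each term of f has total degree < n (min |Aᵢ| - 1), so some exponent eᵢ is < |Aᵢ| - 1, and the
-- sum of that monomial over A₁ × ⋯ × Aₙ has the vanishing power sum over Aᵢ as a factor.
module Submission where

open import Defs hiding (_∈_)
open import Level using (_⊔_)
open import Algebra.Bundles using (CommutativeMonoid; CommutativeRing)
open import Data.Nat as ℕ using (ℕ; zero; suc; z≤n; s≤s)
import Data.Nat.Properties as ℕₚ
open import Data.List using (List; []; _∷_; foldr; length; map)
open import Data.List.Properties using (length-map; length-removeAt)
open import Data.List.Relation.Unary.Any using (here; there; _─_)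
open import Data.List.Relation.Unary.All as All using (All; []; _∷_)
import Data.List.Relation.Unary.All.Properties as All
open import Data.List.Relation.Unary.AllPairs using (_∷_)
open import Data.List.Membership.Setoid.Properties using (∈-resp-≈; All[≉]⇒∉; ∈-map⁺)
open import Data.Vec using (Vec; []; _∷_; lookup)
open import Data.Fin using (Fin; zero; suc)
open import Data.Product using (_×_; _,_; proj₂; ∃-syntax)
open import Data.Empty using (⊥-elim)
open import Function using (_∘_)
open import Relation.Binary.Bundles using (Setoid)
open import Relation.Binary.PropositionalEquality as ≡ using (_≡_)
open import Relation.Nullary using (¬_; yes; no)

module _ {a ℓ} (S : Setoid a ℓ) where

  open Setoid S
  open import Data.List.Membership.Setoid S using (_∈_; _∉_)
  open import Data.List.Relation.Unary.Unique.Setoid S using (Unique)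

  ∈-─⁺ : ∀ {x y xs} (p : x ∈ xs) → y ∈ xs → ¬ y ≈ x → y ∈ (xs ─ p)
  ∈-─⁺ (here x≈a) (here y≈a) y≉x = ⊥-elim (y≉x (trans y≈a (sym x≈a)))
  ∈-─⁺ (here _)   (there q)  _   = q
  ∈-─⁺ (there _)  (here y≈a) _   = here y≈a
  ∈-─⁺ (there p)  (there q)  y≉x = there (∈-─⁺ p q y≉x)

  ∈-─⁻ : ∀ {x y xs} (p : x ∈ xs) → y ∈ (xs ─ p) → y ∈ xs
  ∈-─⁻ (here _)  q         = there q
  ∈-─⁻ (there _) (here e)  = here e
  ∈-─⁻ (there p) (there q) = there (∈-─⁻ p q)

  Unique-─ : ∀ {x xs} (p : x ∈ xs) → Unique xs → Unique (xs ─ p)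
  Unique-─ (here _)  (_ ∷ u)    = u
  Unique-─ (there p) (a≉xs ∷ u) = All.─⁺ p a≉xs ∷ Unique-─ p u

  Unique⇒∉─ : ∀ {x xs} (p : x ∈ xs) → Unique xs → x ∉ (xs ─ p)
  Unique⇒∉─ (here x≈a)   (a≉xs ∷ _) x∈xs       = All[≉]⇒∉ S a≉xs (∈-resp-≈ S x≈a x∈xs)
  Unique⇒∉─ (there x∈xs) (a≉xs ∷ _) (here x≈a) = All[≉]⇒∉ S a≉xs (∈-resp-≈ S x≈a x∈xs)
  Unique⇒∉─ (there p)    (_ ∷ u)    (there q)  = Unique⇒∉─ p u q

module _ {c ℓ} (M : CommutativeMonoid c ℓ) where

  open CommutativeMonoid M
  open import Algebra.Properties.CommutativeSemigroup commutativeSemigroup using (x∙yz≈y∙xz)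
  open import Relation.Binary.Reasoning.Setoid setoid
  open import Data.List.Membership.Setoid setoid using (_∈_)
  open import Data.List.Relation.Binary.Subset.Setoid setoid using (_⊆_)
  open import Data.List.Relation.Unary.Unique.Setoid setoid using (Unique)

  product : List Carrier → Carrier
  product = foldr _∙_ ε

  product-─ : ∀ {x xs} (p : x ∈ xs) → product xs ≈ x ∙ product (xs ─ p)
  product-─ (here x≈a) = ∙-congʳ (sym x≈a)
  product-─ {x} (there {x = a} {xs = xs} p) = begin
    a ∙ product xs                ≈⟨ ∙-congˡ (product-─ p) ⟩
    a ∙ (x ∙ product (xs ─ p))    ≈⟨ x∙yz≈y∙xz a x _ ⟩
    x ∙ (a ∙ product (xs ─ p))    ∎

  Unique∧⊆∧length≤⇒product≈ : ∀ {xs ys} → Unique ys → ys ⊆ xs → length xs ℕ.≤ length ys →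
                              product xs ≈ product ys
  Unique∧⊆∧length≤⇒product≈ {[]}    {[]}     _          _     _   = refl
  Unique∧⊆∧length≤⇒product≈ {_ ∷ _} {[]}     _          _     ()
  Unique∧⊆∧length≤⇒product≈ {xs}    {y ∷ ys} (y∉ys ∷ u) ys⊆xs xs≤ = begin
    product xs                ≈⟨ product-─ y∈xs ⟩
    y ∙ product (xs ─ y∈xs)   ≈⟨ ∙-congˡ (Unique∧⊆∧length≤⇒product≈ u ys⊆xs─y shorter) ⟩
    y ∙ product ys            ∎
    where
    y∈xs : y ∈ xs
    y∈xs = ys⊆xs (here refl)
    ys⊆xs─y : ys ⊆ (xs ─ y∈xs)
    ys⊆xs─y z∈ys = ∈-─⁺ setoid y∈xs (ys⊆xs (there z∈ys))
                     (λ z≈y → All[≉]⇒∉ setoid y∉ys (∈-resp-≈ setoid z≈y z∈ys))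
    shorter : length (xs ─ y∈xs) ℕ.≤ length ys
    shorter = ≡.subst (ℕ._≤ length ys) (≡.sym (length-removeAt xs _)) (ℕₚ.pred-mono-≤ xs≤)

module _ {c ℓ} (R : CommutativeRing c ℓ) where

  open CommutativeRing R hiding (zero)
  open import Algebra.Properties.Ring ring
    using (x∙y⁻¹≈ε⇒x≈y; x≈y⇒x∙y⁻¹≈ε; -‿injective; -0#≈0#; +-identityʳ-unique; ⁻¹-anti-homo‿-; xyx⁻¹≈y)
  open import Algebra.Solver.Ring.NaturalCoefficients.Default commutativeSemiring using (solve; _:+_; _:*_; _:=_)
  open import Relation.Binary.Reasoning.Setoid setoid
  open import Data.List.Membership.Setoid setoid using (_∈_)
  open import Data.List.Relation.Unary.Unique.Setoid setoid using (Unique)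

  NoZeroDivisors : Set (c ⊔ ℓ)
  NoZeroDivisors = ∀ {x y} → ¬ x ≈ 0# → x * y ≈ 0# → y ≈ 0#

  IsField⇒NoZeroDivisors : IsField R → NoZeroDivisors
  IsField⇒NoZeroDivisors isField {x} {y} x≉0 xy≈0 with IsField.inverse isField x x≉0
  ... | x′ , xx′≈1 = begin
    y              ≈⟨ sym (*-identityˡ y) ⟩
    1# * y         ≈⟨ *-congʳ (sym xx′≈1) ⟩
    (x * x′) * y   ≈⟨ solve 3 (λ x x′ y → (x :* x′) :* y := x′ :* (x :* y)) refl x x′ y ⟩
    x′ * (x * y)   ≈⟨ *-congˡ xy≈0 ⟩
    x′ * 0#        ≈⟨ zeroʳ x′ ⟩
    0#             ∎

  x-[x-y]≈y : ∀ x y → x - (x - y) ≈ y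
  x-[x-y]≈y x y = begin
    x + - (x - y)    ≈⟨ +-congˡ (⁻¹-anti-homo‿- x y) ⟩
    x + (y - x)      ≈⟨ sym (+-assoc x y (- x)) ⟩
    x + y - x        ≈⟨ xyx⁻¹≈y x y ⟩
    y                ∎

  x-y≈x⇒y≈0 : ∀ {x y} → x - y ≈ x → y ≈ 0#
  x-y≈x⇒y≈0 {x} {y} x-y≈x = -‿injective (trans (+-identityʳ-unique x (- y) x-y≈x) (sym -0#≈0#))

  -- The fold inside sumOver, so that sumOver R (A ∷ As) g reduces to a sum over A.
  sum : (Carrier → Carrier) → List Carrier → Carrier
  sum f = foldr (λ a acc → f a + acc) 0#

  sum-cong : ∀ {f g} (A : List Carrier) → (∀ a → f a ≈ g a) → sum f A ≈ sum g A
  sum-cong []      f≈g = refl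
  sum-cong (a ∷ A) f≈g = +-cong (f≈g a) (sum-cong A f≈g)

  sum-zero : ∀ {f} (A : List Carrier) → (∀ a → f a ≈ 0#) → sum f A ≈ 0#
  sum-zero []      f≈0 = refl
  sum-zero (a ∷ A) f≈0 = trans (+-cong (f≈0 a) (sum-zero A f≈0)) (+-identityˡ 0#)

  sum-+ : ∀ f g (A : List Carrier) → sum (λ a → f a + g a) A ≈ sum f A + sum g A
  sum-+ f g []      = sym (+-identityˡ 0#)
  sum-+ f g (a ∷ A) = trans (+-congˡ (sum-+ f g A))
    (solve 4 (λ x y u v → (x :+ y) :+ (u :+ v) := (x :+ u) :+ (y :+ v)) refl (f a) (g a) (sum f A) (sum g A))

  sum-*ˡ : ∀ k f (A : List Carrier) → sum (λ a → k * f a) A ≈ k * sum f A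
  sum-*ˡ k f []      = sym (zeroʳ k)
  sum-*ˡ k f (a ∷ A) = trans (+-congˡ (sum-*ˡ k f A)) (sym (distribˡ k (f a) (sum f A)))

  sum-*ʳ : ∀ k f (A : List Carrier) → sum (λ a → f a * k) A ≈ sum f A * k
  sum-*ʳ k f []      = sym (zeroˡ k)
  sum-*ʳ k f (a ∷ A) = trans (+-congˡ (sum-*ʳ k f A)) (sym (distribʳ k (f a) (sum f A)))

  prod : List Carrier → Carrier
  prod = product *-commutativeMonoid

  ∈⇒prod-map-sub≈0 : ∀ {x bs} → x ∈ bs → prod (map (_-_ x) bs) ≈ 0#
  ∈⇒prod-map-sub≈0 (here x≈b) = trans (*-congʳ (x≈y⇒x∙y⁻¹≈ε x≈b)) (zeroˡ _)
  ∈⇒prod-map-sub≈0 (there p)  = trans (*-congˡ (∈⇒prod-map-sub≈0 p)) (zeroʳ _)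

  pow-cong : ∀ {x y} → x ≈ y → ∀ j → pow R x j ≈ pow R y j
  pow-cong x≈y zero    = refl
  pow-cong x≈y (suc j) = *-cong x≈y (pow-cong x≈y j)

  -- Univariate polynomials are lists of coefficients, constant term first.

  ⟦_⟧ : List Carrier → Carrier → Carrier
  ⟦ []    ⟧ x = 0#
  ⟦ a ∷ p ⟧ x = a + x * ⟦ p ⟧ x

  coeff : List Carrier → ℕ → Carrier
  coeff []      k       = 0#
  coeff (a ∷ p) zero    = a
  coeff (a ∷ p) (suc k) = coeff p k

  length≤⇒coeff≈0 : ∀ p {k} → length p ℕ.≤ k → coeff p k ≈ 0#
  length≤⇒coeff≈0 []      _       = refl
  length≤⇒coeff≈0 (a ∷ p) (s≤s h) = length≤⇒coeff≈0 p h

  All≈0⇒coeff≈0 : ∀ {p} → All (_≈ 0#) p → ∀ k → coeff p k ≈ 0#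
  All≈0⇒coeff≈0 []         k       = refl
  All≈0⇒coeff≈0 (a≈0 ∷ _)  zero    = a≈0
  All≈0⇒coeff≈0 (_ ∷ p≈0)  (suc k) = All≈0⇒coeff≈0 p≈0 k

  infixl 6 _⊞_
  _⊞_ : List Carrier → List Carrier → List Carrier
  []      ⊞ q       = q
  (a ∷ p) ⊞ []      = a ∷ p
  (a ∷ p) ⊞ (b ∷ q) = (a + b) ∷ (p ⊞ q)

  ⟦⊞⟧ : ∀ p q x → ⟦ p ⊞ q ⟧ x ≈ ⟦ p ⟧ x + ⟦ q ⟧ x
  ⟦⊞⟧ []      q       x = sym (+-identityˡ _)
  ⟦⊞⟧ (a ∷ p) []      x = sym (+-identityʳ _)
  ⟦⊞⟧ (a ∷ p) (b ∷ q) x = trans (+-congˡ (*-congˡ (⟦⊞⟧ p q x)))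
    (solve 5 (λ a b x P Q → (a :+ b) :+ x :* (P :+ Q) := (a :+ x :* P) :+ (b :+ x :* Q)) refl a b x (⟦ p ⟧ x) (⟦ q ⟧ x))

  coeff-⊞ : ∀ p q k → coeff (p ⊞ q) k ≈ coeff p k + coeff q k
  coeff-⊞ []      q       k       = sym (+-identityˡ _)
  coeff-⊞ (a ∷ p) []      zero    = sym (+-identityʳ _)
  coeff-⊞ (a ∷ p) []      (suc k) = sym (+-identityʳ _)
  coeff-⊞ (a ∷ p) (b ∷ q) zero    = refl
  coeff-⊞ (a ∷ p) (b ∷ q) (suc k) = coeff-⊞ p q k

  length-⊞ : ∀ p q {n} → length p ℕ.≤ n → length q ℕ.≤ n → length (p ⊞ q) ℕ.≤ n
  length-⊞ []      q       _       q≤n     = q≤n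
  length-⊞ (a ∷ p) []      p≤n     _       = p≤n
  length-⊞ (a ∷ p) (b ∷ q) (s≤s p≤n) (s≤s q≤n) = s≤s (length-⊞ p q p≤n q≤n)

  scale : Carrier → List Carrier → List Carrier
  scale k = map (k *_)

  ⟦scale⟧ : ∀ k p x → ⟦ scale k p ⟧ x ≈ k * ⟦ p ⟧ x
  ⟦scale⟧ k []      x = sym (zeroʳ k)
  ⟦scale⟧ k (a ∷ p) x = trans (+-congˡ (*-congˡ (⟦scale⟧ k p x)))
    (solve 4 (λ k a x P → k :* a :+ x :* (k :* P) := k :* (a :+ x :* P)) refl k a x (⟦ p ⟧ x))

  coeff-scale : ∀ k p m → coeff (scale k p) m ≈ k * coeff p m
  coeff-scale k []      m       = sym (zeroʳ k)
  coeff-scale k (a ∷ p) zero    = refl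
  coeff-scale k (a ∷ p) (suc m) = coeff-scale k p m

  length-scale : ∀ k p {n} → length p ℕ.≤ n → length (scale k p) ℕ.≤ n
  length-scale k p = ≡.subst (ℕ._≤ _) (≡.sym (length-map (k *_) p))

  X^_ : ℕ → List Carrier
  X^ zero  = 1# ∷ []
  X^ suc j = 0# ∷ X^ j

  ⟦X^⟧ : ∀ j x → ⟦ X^ j ⟧ x ≈ pow R x j
  ⟦X^⟧ zero    x = trans (+-congˡ (zeroʳ x)) (+-identityʳ 1#)
  ⟦X^⟧ (suc j) x = trans (+-identityˡ _) (*-congˡ (⟦X^⟧ j x))

  length-X^ : ∀ j → length (X^ j) ≡ suc j
  length-X^ zero    = ≡.refl
  length-X^ (suc j) = ≡.cong suc (length-X^ j)

  ⟨X-_⟩*_ : Carrier → List Carrier → List Carrier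
  ⟨X- b ⟩* p = (0# ∷ p) ⊞ scale (- b) p

  ⟦⟨X-⟩*⟧ : ∀ b p x → ⟦ ⟨X- b ⟩* p ⟧ x ≈ (x - b) * ⟦ p ⟧ x
  ⟦⟨X-⟩*⟧ b p x = begin
    ⟦ (0# ∷ p) ⊞ scale (- b) p ⟧ x            ≈⟨ ⟦⊞⟧ (0# ∷ p) (scale (- b) p) x ⟩
    (0# + x * ⟦ p ⟧ x) + ⟦ scale (- b) p ⟧ x  ≈⟨ +-cong (+-identityˡ _) (⟦scale⟧ (- b) p x) ⟩
    x * ⟦ p ⟧ x + - b * ⟦ p ⟧ x               ≈⟨ sym (distribʳ (⟦ p ⟧ x) x (- b)) ⟩
    (x - b) * ⟦ p ⟧ x                          ∎

  coeff-⟨X-⟩* : ∀ b p k → coeff (⟨X- b ⟩* p) k ≈ coeff (0# ∷ p) k + - b * coeff p k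
  coeff-⟨X-⟩* b p k = trans (coeff-⊞ (0# ∷ p) (scale (- b) p) k) (+-congˡ (coeff-scale (- b) p k))

  length-⟨X-⟩* : ∀ b p {n} → length p ℕ.≤ n → length (⟨X- b ⟩* p) ℕ.≤ suc n
  length-⟨X-⟩* b p p≤n = length-⊞ (0# ∷ p) (scale (- b) p) (s≤s p≤n) (length-scale (- b) p (ℕₚ.m≤n⇒m≤1+n p≤n))

  vanishing : List Carrier → List Carrier
  vanishing []       = 1# ∷ []
  vanishing (b ∷ bs) = ⟨X- b ⟩* vanishing bs

  ⟦vanishing⟧ : ∀ bs x → ⟦ vanishing bs ⟧ x ≈ prod (map (_-_ x) bs)
  ⟦vanishing⟧ []       x = trans (+-congˡ (zeroʳ x)) (+-identityʳ 1#)
  ⟦vanishing⟧ (b ∷ bs) x = trans (⟦⟨X-⟩*⟧ b (vanishing bs) x) (*-congˡ (⟦vanishing⟧ bs x))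

  length-vanishing : ∀ bs → length (vanishing bs) ℕ.≤ suc (length bs)
  length-vanishing []       = ℕₚ.≤-refl
  length-vanishing (b ∷ bs) = length-⟨X-⟩* b (vanishing bs) (length-vanishing bs)

  coeff-vanishing : ∀ bs → coeff (vanishing bs) (length bs) ≈ 1#
  coeff-vanishing []       = refl
  coeff-vanishing (b ∷ bs) = begin
    coeff (⟨X- b ⟩* V) (suc (length bs))
      ≈⟨ coeff-⟨X-⟩* b V (suc (length bs)) ⟩
    coeff V (length bs) + - b * coeff V (suc (length bs))
      ≈⟨ +-cong (coeff-vanishing bs) (*-congˡ (length≤⇒coeff≈0 V (length-vanishing bs))) ⟩
    1# + - b * 0#
      ≈⟨ trans (+-congˡ (zeroʳ (- b))) (+-identityʳ 1#) ⟩
    1# ∎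
    where V = vanishing bs

  -- Synthetic division by X - x₀; the remainder is ⟦ g ⟧ x₀.
  quotient : Carrier → List Carrier → List Carrier
  quotient x₀ []          = []
  quotient x₀ (a ∷ [])    = []
  quotient x₀ (a ∷ b ∷ p) = ⟦ b ∷ p ⟧ x₀ ∷ quotient x₀ (b ∷ p)

  ⟦⟧-division : ∀ x₀ g x → ⟦ g ⟧ x ≈ ⟦ g ⟧ x₀ + (x - x₀) * ⟦ quotient x₀ g ⟧ x
  ⟦⟧-division x₀ []          x = sym (trans (+-identityˡ _) (zeroʳ _))
  ⟦⟧-division x₀ (a ∷ [])    x = begin
    a + x * 0#                   ≈⟨ +-congˡ (trans (zeroʳ x) (sym (zeroʳ x₀))) ⟩
    a + x₀ * 0#                  ≈⟨ sym (+-identityʳ _) ⟩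
    a + x₀ * 0# + 0#             ≈⟨ +-congˡ (sym (zeroʳ (x - x₀))) ⟩
    a + x₀ * 0# + (x - x₀) * 0#  ∎
  ⟦⟧-division x₀ (a ∷ b ∷ p) x = begin
    a + x * ⟦ b ∷ p ⟧ x
      ≈⟨ +-congˡ (*-cong x≈x₀+d (⟦⟧-division x₀ (b ∷ p) x)) ⟩
    a + (x₀ + d) * (r + d * h)
      ≈⟨ solve 5 (λ a x₀ d r h → a :+ (x₀ :+ d) :* (r :+ d :* h) := (a :+ x₀ :* r) :+ d :* (r :+ (x₀ :+ d) :* h))
               refl a x₀ d r h ⟩
    a + x₀ * r + d * (r + (x₀ + d) * h)
      ≈⟨ +-congˡ (*-congˡ (+-congˡ (*-congʳ (sym x≈x₀+d)))) ⟩
    a + x₀ * r + d * (r + x * h) ∎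
    where
    d = x - x₀
    r = ⟦ b ∷ p ⟧ x₀
    h = ⟦ quotient x₀ (b ∷ p) ⟧ x
    x≈x₀+d : x ≈ x₀ + d
    x≈x₀+d = sym (trans (sym (+-assoc x₀ x (- x₀))) (xyx⁻¹≈y x₀ x))

  length-quotient : ∀ x₀ g → length (quotient x₀ g) ≡ ℕ.pred (length g)
  length-quotient x₀ []          = ≡.refl
  length-quotient x₀ (a ∷ [])    = ≡.refl
  length-quotient x₀ (a ∷ b ∷ p) = ≡.cong suc (length-quotient x₀ (b ∷ p))

  quotient≈0∧root⇒≈0 : ∀ x₀ g → All (_≈ 0#) (quotient x₀ g) → ⟦ g ⟧ x₀ ≈ 0# → All (_≈ 0#) g
  quotient≈0∧root⇒≈0 x₀ []          _           _       = []
  quotient≈0∧root⇒≈0 x₀ (a ∷ [])    _           g[x₀]≈0 =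
    trans (sym (trans (+-congˡ (zeroʳ x₀)) (+-identityʳ a))) g[x₀]≈0 ∷ []
  quotient≈0∧root⇒≈0 x₀ (a ∷ b ∷ p) (r≈0 ∷ q≈0) g[x₀]≈0 =
    trans (sym (trans (+-congˡ (trans (*-congˡ r≈0) (zeroʳ x₀))) (+-identityʳ a))) g[x₀]≈0
    ∷ quotient≈0∧root⇒≈0 x₀ (b ∷ p) q≈0 r≈0

  length≤roots⇒≈0 : NoZeroDivisors → ∀ {xs} → Unique xs → ∀ g → length g ℕ.≤ length xs →
                    All (λ x → ⟦ g ⟧ x ≈ 0#) xs → All (_≈ 0#) g
  length≤roots⇒≈0 _   {[]}      _           [] _  _                     = []
  length≤roots⇒≈0 nzd {x₀ ∷ xs} (x₀∉xs ∷ u) g g≤ (g[x₀]≈0 ∷ g[xs]≈0) =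
    quotient≈0∧root⇒≈0 x₀ g
      (length≤roots⇒≈0 nzd u (quotient x₀ g) q≤ (All.zipWith quotient-root (x₀∉xs , g[xs]≈0)))
      g[x₀]≈0
    where
    q≤ : length (quotient x₀ g) ℕ.≤ length xs
    q≤ = ≡.subst (ℕ._≤ length xs) (≡.sym (length-quotient x₀ g)) (ℕₚ.pred-mono-≤ g≤)
    quotient-root : ∀ {y} → ¬ x₀ ≈ y × ⟦ g ⟧ y ≈ 0# → ⟦ quotient x₀ g ⟧ y ≈ 0#
    quotient-root {y} (x₀≉y , g[y]≈0) = nzd (λ y-x₀≈0 → x₀≉y (sym (x∙y⁻¹≈ε⇒x≈y y x₀ y-x₀≈0))) (begin
      (y - x₀) * ⟦ quotient x₀ g ⟧ y              ≈⟨ sym (+-identityˡ _) ⟩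
      0# + (y - x₀) * ⟦ quotient x₀ g ⟧ y         ≈⟨ +-congʳ (sym g[x₀]≈0) ⟩
      ⟦ g ⟧ x₀ + (y - x₀) * ⟦ quotient x₀ g ⟧ y   ≈⟨ sym (⟦⟧-division x₀ g y) ⟩
      ⟦ g ⟧ y                                     ≈⟨ g[y]≈0 ⟩
      0#                                          ∎)

  -- lagrange ψ A = Σ_{a ∈ A} ψ a · ∏_{b ∈ A, b ≠ a} (X - b)
  lagrange : (Carrier → Carrier) → List Carrier → List Carrier
  lagrange ψ []      = []
  lagrange ψ (a ∷ A) = scale (ψ a) (vanishing A) ⊞ ⟨X- a ⟩* lagrange ψ A

  length-lagrange : ∀ ψ A → length (lagrange ψ A) ℕ.≤ length A
  length-lagrange ψ []      = z≤n
  length-lagrange ψ (a ∷ A) = length-⊞ (scale (ψ a) (vanishing A)) (⟨X- a ⟩* lagrange ψ A)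
    (length-scale (ψ a) (vanishing A) (length-vanishing A))
    (length-⟨X-⟩* a (lagrange ψ A) (length-lagrange ψ A))

  ⟦lagrange-∷⟧ : ∀ ψ a A x →
                 ⟦ lagrange ψ (a ∷ A) ⟧ x ≈ ψ a * prod (map (_-_ x) A) + (x - a) * ⟦ lagrange ψ A ⟧ x
  ⟦lagrange-∷⟧ ψ a A x = trans (⟦⊞⟧ (scale (ψ a) (vanishing A)) (⟨X- a ⟩* lagrange ψ A) x)
    (+-cong (trans (⟦scale⟧ (ψ a) (vanishing A) x) (*-congˡ (⟦vanishing⟧ A x))) (⟦⟨X-⟩*⟧ a (lagrange ψ A) x))

  ⟦lagrange⟧-node : ∀ ψ → (∀ {a b} → a ≈ b → ψ a ≈ ψ b) → ∀ {x A} (p : x ∈ A) →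
                    ⟦ lagrange ψ A ⟧ x ≈ ψ x * prod (map (_-_ x) (A ─ p))
  ⟦lagrange⟧-node ψ ψ-cong {x} {a ∷ A} (here x≈a) = begin
    ⟦ lagrange ψ (a ∷ A) ⟧ x
      ≈⟨ ⟦lagrange-∷⟧ ψ a A x ⟩
    ψ a * prod (map (_-_ x) A) + (x - a) * ⟦ lagrange ψ A ⟧ x
      ≈⟨ +-cong (*-congʳ (ψ-cong (sym x≈a))) (trans (*-congʳ (x≈y⇒x∙y⁻¹≈ε x≈a)) (zeroˡ _)) ⟩
    ψ x * prod (map (_-_ x) A) + 0#
      ≈⟨ +-identityʳ _ ⟩
    ψ x * prod (map (_-_ x) A) ∎
  ⟦lagrange⟧-node ψ ψ-cong {x} {a ∷ A} (there p) = begin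
    ⟦ lagrange ψ (a ∷ A) ⟧ x
      ≈⟨ ⟦lagrange-∷⟧ ψ a A x ⟩
    ψ a * prod (map (_-_ x) A) + (x - a) * ⟦ lagrange ψ A ⟧ x
      ≈⟨ +-cong (trans (*-congˡ (∈⇒prod-map-sub≈0 p)) (zeroʳ _)) (*-congˡ (⟦lagrange⟧-node ψ ψ-cong p)) ⟩
    0# + (x - a) * (ψ x * prod (map (_-_ x) (A ─ p)))
      ≈⟨ +-identityˡ _ ⟩
    (x - a) * (ψ x * prod (map (_-_ x) (A ─ p)))
      ≈⟨ solve 3 (λ u v w → u :* (v :* w) := v :* (u :* w)) refl (x - a) (ψ x) _ ⟩
    ψ x * ((x - a) * prod (map (_-_ x) (A ─ p))) ∎

  -- 0# ∷ p is X·p: this is the coefficient of X^{|A| - 1} in lagrange ψ A.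
  coeff-lagrange : ∀ ψ A → coeff (0# ∷ lagrange ψ A) (length A) ≈ sum ψ A
  coeff-lagrange ψ []      = refl
  coeff-lagrange ψ (a ∷ A) = begin
    coeff (scale (ψ a) V ⊞ ⟨X- a ⟩* L) n
      ≈⟨ coeff-⊞ (scale (ψ a) V) (⟨X- a ⟩* L) n ⟩
    coeff (scale (ψ a) V) n + coeff (⟨X- a ⟩* L) n
      ≈⟨ +-cong (coeff-scale (ψ a) V n) (coeff-⟨X-⟩* a L n) ⟩
    ψ a * coeff V n + (coeff (0# ∷ L) n + - a * coeff L n)
      ≈⟨ +-cong (*-congˡ (coeff-vanishing A))
                (+-cong (coeff-lagrange ψ A) (*-congˡ (length≤⇒coeff≈0 L (length-lagrange ψ A)))) ⟩
    ψ a * 1# + (sum ψ A + - a * 0#)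
      ≈⟨ +-cong (*-identityʳ (ψ a)) (trans (+-congˡ (zeroʳ (- a))) (+-identityʳ _)) ⟩
    ψ a + sum ψ A ∎
    where
    V = vanishing A
    L = lagrange ψ A
    n = length A

  prod-map-sub≈prod-nonzero : ∀ {A} (S : IsFiniteAdditiveSubgroup R A) →
                              let open IsFiniteAdditiveSubgroup S in
                              ∀ {x} (p : x ∈ A) → prod (map (_-_ x) (A ─ p)) ≈ prod (A ─ zero-mem)
  prod-map-sub≈prod-nonzero {A} S {x} p =
    Unique∧⊆∧length≤⇒product≈ *-commutativeMonoid (Unique-─ setoid zero-mem distinct) translate same-length
    where
    open IsFiniteAdditiveSubgroup S
    translate : ∀ {y} → y ∈ (A ─ zero-mem) → y ∈ map (_-_ x) (A ─ p)
    translate {y} y∈A─0 = ∈-resp-≈ setoid (x-[x-y]≈y x y) (∈-map⁺ setoid setoid (+-congˡ ∘ -‿cong) x-y∈A─x)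
      where
      y∈A = ∈-─⁻ setoid zero-mem y∈A─0
      y≉0 : ¬ y ≈ 0#
      y≉0 y≈0 = Unique⇒∉─ setoid zero-mem distinct (∈-resp-≈ setoid y≈0 y∈A─0)
      x-y∈A─x : (x - y) ∈ (A ─ p)
      x-y∈A─x = ∈-─⁺ setoid p (+-closed x (- y) p (neg-closed y y∈A)) (y≉0 ∘ x-y≈x⇒y≈0)
    same-length : length (map (_-_ x) (A ─ p)) ℕ.≤ length (A ─ zero-mem)
    same-length = ℕₚ.≤-reflexive (≡.trans (length-map (_-_ x) (A ─ p))
                    (≡.trans (length-removeAt A _) (≡.sym (length-removeAt A _))))

  sum-pow≈0 : NoZeroDivisors → ∀ {A} → IsFiniteAdditiveSubgroup R A →
              ∀ j → j ℕ.< length A ℕ.∸ 1 → sum (λ a → pow R a j) A ≈ 0#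
  sum-pow≈0 nzd {[]}    S j ()
  sum-pow≈0 nzd {a ∷ A} S j j<n = begin
    sum xʲ (a ∷ A)                            ≈⟨ sym (coeff-lagrange xʲ (a ∷ A)) ⟩
    coeff L n                                 ≈⟨ sym (+-identityʳ _) ⟩
    coeff L n + 0#                            ≈⟨ +-congˡ (sym DXʲ-coeff≈0) ⟩
    coeff L n + coeff (scale (- D) (X^ j)) n  ≈⟨ sym (coeff-⊞ L _ n) ⟩
    coeff Q n                                 ≈⟨ All≈0⇒coeff≈0 Q≈0 n ⟩
    0#                                        ∎
    where
    open IsFiniteAdditiveSubgroup S
    xʲ : Carrier → Carrier
    xʲ x = pow R x j
    n = length A
    D = prod ((a ∷ A) ─ zero-mem)
    L = lagrange xʲ (a ∷ A)
    Q = L ⊞ scale (- D) (X^ j)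
    Xʲ≤n : length (X^ j) ℕ.≤ n
    Xʲ≤n = ≡.subst (ℕ._≤ n) (≡.sym (length-X^ j)) j<n
    DXʲ-coeff≈0 : coeff (scale (- D) (X^ j)) n ≈ 0#
    DXʲ-coeff≈0 = trans (coeff-scale (- D) (X^ j) n) (trans (*-congˡ (length≤⇒coeff≈0 (X^ j) Xʲ≤n)) (zeroʳ _))
    Q-root : ∀ {x} → x ∈ a ∷ A → ⟦ Q ⟧ x ≈ 0#
    Q-root {x} p = begin
      ⟦ Q ⟧ x                                               ≈⟨ ⟦⊞⟧ L _ x ⟩
      ⟦ L ⟧ x + ⟦ scale (- D) (X^ j) ⟧ x
        ≈⟨ +-cong (⟦lagrange⟧-node xʲ (λ e → pow-cong e j) p)
                  (trans (⟦scale⟧ (- D) (X^ j) x) (*-congˡ (⟦X^⟧ j x))) ⟩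
      xʲ x * prod (map (_-_ x) ((a ∷ A) ─ p)) + - D * xʲ x
        ≈⟨ +-congʳ (*-congˡ (prod-map-sub≈prod-nonzero S p)) ⟩
      xʲ x * D + - D * xʲ x                                 ≈⟨ +-congʳ (*-comm _ _) ⟩
      D * xʲ x + - D * xʲ x                                 ≈⟨ sym (distribʳ _ D (- D)) ⟩
      (D - D) * xʲ x                                        ≈⟨ *-congʳ (-‿inverseʳ D) ⟩
      0# * xʲ x                                             ≈⟨ zeroˡ _ ⟩
      0#                                                    ∎
    Q≈0 : All (_≈ 0#) Q
    Q≈0 = length≤roots⇒≈0 nzd distinct Q
      (length-⊞ L _ (length-lagrange xʲ (a ∷ A)) (length-scale (- D) (X^ j) (ℕₚ.m≤n⇒m≤1+n Xʲ≤n)))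
      (All.tabulateₛ setoid Q-root)

  sumOver-zero : ∀ {n} (As : Vec (List Carrier) n) {g} → (∀ v → g v ≈ 0#) → sumOver R As g ≈ 0#
  sumOver-zero []       g≈0 = g≈0 []
  sumOver-zero (A ∷ As) g≈0 = sum-zero A (λ a → sumOver-zero As (λ v → g≈0 (a ∷ v)))

  sumOver-+ : ∀ {n} (As : Vec (List Carrier) n) g h →
              sumOver R As (λ v → g v + h v) ≈ sumOver R As g + sumOver R As h
  sumOver-+ []       g h = refl
  sumOver-+ (A ∷ As) g h = trans (sum-cong A (λ a → sumOver-+ As (λ v → g (a ∷ v)) (λ v → h (a ∷ v))))
                                 (sum-+ _ _ A)

  sumOver-*ˡ : ∀ {n} (As : Vec (List Carrier) n) k g → sumOver R As (λ v → k * g v) ≈ k * sumOver R As g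
  sumOver-*ˡ []       k g = refl
  sumOver-*ˡ (A ∷ As) k g = trans (sum-cong A (λ a → sumOver-*ˡ As k (λ v → g (a ∷ v)))) (sum-*ˡ k _ A)

  sumOver-monomial≈0 : ∀ {n} (As : Vec (List Carrier) n) es (i : Fin n) →
                       sum (λ a → pow R a (lookup es i)) (lookup As i) ≈ 0# →
                       sumOver R As (monomial R es) ≈ 0#
  sumOver-monomial≈0 (A ∷ As) (e ∷ es) zero    powSum≈0 = begin
    sum (λ a → sumOver R As (λ v → pow R a e * monomial R es v)) A
      ≈⟨ sum-cong A (λ a → sumOver-*ˡ As (pow R a e) (monomial R es)) ⟩
    sum (λ a → pow R a e * sumOver R As (monomial R es)) A
      ≈⟨ sum-*ʳ _ (λ a → pow R a e) A ⟩
    sum (λ a → pow R a e) A * sumOver R As (monomial R es)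
      ≈⟨ *-congʳ powSum≈0 ⟩
    0# * sumOver R As (monomial R es)
      ≈⟨ zeroˡ _ ⟩
    0# ∎
  sumOver-monomial≈0 (A ∷ As) (e ∷ es) (suc i) powSum≈0 = sum-zero A (λ a →
    trans (sumOver-*ˡ As (pow R a e) (monomial R es))
          (trans (*-congˡ (sumOver-monomial≈0 As es i powSum≈0)) (zeroʳ _)))

  sumOver-eval≈0 : ∀ {n} (As : Vec (List Carrier) n) (f : Poly R n) →
                   All (λ t → sumOver R As (monomial R (proj₂ t)) ≈ 0#) f → sumOver R As (eval R f) ≈ 0#
  sumOver-eval≈0 As []             []             = sumOver-zero As (λ _ → refl)
  sumOver-eval≈0 As ((a , es) ∷ f) (term≈0 ∷ f≈0) = begin
    sumOver R As (λ v → a * monomial R es v + eval R f v)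
      ≈⟨ sumOver-+ As _ _ ⟩
    sumOver R As (λ v → a * monomial R es v) + sumOver R As (eval R f)
      ≈⟨ +-cong (sumOver-*ˡ As a (monomial R es)) (sumOver-eval≈0 As f f≈0) ⟩
    a * sumOver R As (monomial R es) + 0#
      ≈⟨ +-identityʳ _ ⟩
    a * sumOver R As (monomial R es)
      ≈⟨ *-congˡ term≈0 ⟩
    a * 0#
      ≈⟨ zeroʳ a ⟩
    0# ∎

  deg<⇒All-expSum< : ∀ {n N} (f : Poly R n) → deg R f ℕ.< N → All (λ t → expSum R (proj₂ t) ℕ.< N) f
  deg<⇒All-expSum< []             _     = []
  deg<⇒All-expSum< ((_ , es) ∷ f) deg<N =
    ℕₚ.≤-<-trans (ℕₚ.m≤m⊔n (expSum R es) (deg R f)) deg<N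
    ∷ deg<⇒All-expSum< f (ℕₚ.≤-<-trans (ℕₚ.m≤n⊔m (expSum R es) (deg R f)) deg<N)

  expSum<*⇒∃lookup< : ∀ {n} (es : Vec ℕ n) k → expSum R es ℕ.< n ℕ.* k → ∃[ i ] lookup es i ℕ.< k
  expSum<*⇒∃lookup< {suc n} (e ∷ es) k sum< with e ℕ.<? k
  ... | yes e<k = zero , e<k
  ... | no  e≮k with expSum R es ℕ.<? n ℕ.* k
  ...   | yes es< = let i , eᵢ<k = expSum<*⇒∃lookup< es k es< in suc i , eᵢ<k
  ...   | no  es≮ = ⊥-elim (ℕₚ.<⇒≱ sum< (ℕₚ.+-mono-≤ (ℕₚ.≮⇒≥ e≮k) (ℕₚ.≮⇒≥ es≮)))

  minCard≤length : ∀ {n} (As : Vec (List Carrier) n) i → minCard R As ℕ.≤ length (lookup As i)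
  minCard≤length (A ∷ [])     zero    = ℕₚ.≤-refl
  minCard≤length (A ∷ B ∷ As) zero    = ℕₚ.m⊓n≤m _ _
  minCard≤length (A ∷ B ∷ As) (suc i) = ℕₚ.≤-trans (ℕₚ.m⊓n≤n _ _) (minCard≤length (B ∷ As) i)

open import Data.Nat using (_<_; _*_; _∸_)

corollary5p6 : ∀ {c ℓ} (F : CommutativeRing c ℓ) → IsField F
    → ∃[ p ] HasCharacteristic F p
    → (n : ℕ) (As : Vec (List (CommutativeRing.Carrier F)) n)
    → (∀ (i : Fin n) → IsFiniteAdditiveSubgroup F (lookup As i))
    → (f : Poly F n)
    → deg F f < n * (minCard F As ∸ 1)
    → CommutativeRing._≈_ F (sumOver F As (eval F f)) (CommutativeRing.0# F)
-- The characteristic is unused: the argument works over any field (in characteristic 0 every Aᵢ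
-- is {0}, so the degree bound cannot hold).
corollary5p6 F isField _ n As subgroups f deg<bound =
  sumOver-eval≈0 F As f (All.map (λ {t} → termSum≈0 (proj₂ t)) (deg<⇒All-expSum< F f deg<bound))
  where
  open CommutativeRing F using (_≈_; 0#)
  termSum≈0 : ∀ es → expSum F es < n * (minCard F As ∸ 1) → sumOver F As (monomial F es) ≈ 0#
  termSum≈0 es expSum< with expSum<*⇒∃lookup< F es _ expSum<
  ... | i , eᵢ< = sumOver-monomial≈0 F As es i
        (sum-pow≈0 F (IsField⇒NoZeroDivisors F isField) (subgroups i) (lookup es i)
          (ℕₚ.≤-trans eᵢ< (ℕₚ.∸-monoˡ-≤ 1 (minCard≤length F As i))))
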